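{- Let $\lambda_1\ge\mu_1$ be positive integers with $\gcd(\lambda_1+1,\mu_1+1)=1$ and $2\mu_1>\lambda_1+1$. Then the pair $(\lambda_1,\mu_1)$ is $(\lambda_1+1)$-initial.
   Context: For a positive integer $r$, a partition with at most $r$ parts is written as a non-increasing $r$-tuple of nonnegative integers; $\mathrm{Par}_r(n)$ is the set of such tuples with entries summing to $n$. For $\lambda,\mu\in\mathrm{Par}_r(n)$, $\lambda$ dominates $\mu$ if $\sum_{i=1}^k\lambda_i\ge\sum_{i=1}^k\mu_i$ for all $k\le r$. The $r$-Kostka cone $\mathcal{K}_r\subseteq\mathbb{R}^{2r}$ is the convex hull of all points $(\lambda_1,\dots,\lambda_r,\mu_1,\dots,\mu_r)$ with $\lambda,\mu\in\mathrm{Par}_r(n)$ for some $n$ and $\lambda$ dominating $\mu$; it is a pointed rational polyhedral cone. Its Hilbert basis is the unique minimal finite set of integer points of $\mathcal{K}_r$ such that every integer point of $\mathcal{K}_r$ is a nonnegative integer combination of them; equivalently, the set of integer points of $\mathcal{K}_r$ that are not nonnegative integer combinations of other integer points of $\mathcal{K}_r$. An integer pair $(\lambda_1,\mu_1)$ is called $r$-initial if there is an element $(\lambda,\mu)$ of the Hilbert basis of $\mathcal{K}_r$ such that the first entry of $\lambda$ is $\lambda_1$ and the first entry of $\mu$ is $\mu_1$. -}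

module Defs where

open import Data.Nat using (ℕ; zero; suc; _+_; _≤_)
open import Data.Fin using (Fin; toℕ)
open import Data.Vec using (Vec; lookup; toList; zipWith; replicate; head)
open import Data.List using (take)
open import Data.Nat.ListAction using (sum)
open import Data.Product using (_×_; _,_; ∃; ∃-syntax)
open import Data.Sum using (_⊎_)
open import Data.Empty using (⊥)
open import Relation.Binary.PropositionalEquality using (_≡_)
open import Relation.Nullary using (¬_)

-- A point of ℤ^{2r} with nonnegative entries, written (λ , μ).
Point : ℕ → Set
Point r = Vec ℕ r × Vec ℕ r

NonIncreasing : {r : ℕ} → Vec ℕ r → Set
NonIncreasing {r} v = (i j : Fin r) → toℕ i ≤ toℕ j → lookup v j ≤ lookup v i

total : {r : ℕ} → Vec ℕ r → ℕ
total v = sum (toList v)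

psum : {r : ℕ} → ℕ → Vec ℕ r → ℕ
psum k v = sum (take k (toList v))

Dominates : {r : ℕ} → Vec ℕ r → Vec ℕ r → Set
Dominates {r} lam mu = (k : ℕ) → k ≤ r → psum k mu ≤ psum k lam

-- Integer points of the r-Kostka cone: pairs (λ , μ) with λ, μ ∈ Par_r(n)
-- for a common n, and λ dominating μ.
KostkaPoint : (r : ℕ) → Point r → Set
KostkaPoint r (lam , mu) =
  NonIncreasing lam × NonIncreasing mu × total lam ≡ total mu × Dominates lam mu

zeroPt : (r : ℕ) → Point r
zeroPt r = replicate r 0 , replicate r 0

_⊕_ : {r : ℕ} → Point r → Point r → Point r
(a , b) ⊕ (c , d) = zipWith _+_ a c , zipWith _+_ b d

-- Hilbert basis of the (pointed) cone K_r: the irreducible integer points,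
-- i.e. nonzero integer points that are not a sum of two nonzero integer points.
InHilbertBasis : (r : ℕ) → Point r → Set
InHilbertBasis r x =
  KostkaPoint r x × ¬ (x ≡ zeroPt r) ×
  ((y z : Point r) → KostkaPoint r y → KostkaPoint r z → x ≡ y ⊕ z →
     (y ≡ zeroPt r) ⊎ (z ≡ zeroPt r))

-- (λ₁ , μ₁) is r-initial (only meaningful for r ≥ 1)
Initial : (r : ℕ) → ℕ → ℕ → Set
Initial zero l1 m1 = ⊥
Initial (suc r) l1 m1 =
  ∃[ x ] (InHilbertBasis (suc r) x × head (Data.Product.proj₁ x) ≡ l1
                                   × head (Data.Product.proj₂ x) ≡ m1)

-- Put r = λ₁ + 1, B = λ₁ − μ₁ and A = μ₁ − B + 1, so that r = A + 2B and
-- μ₁ + 1 = A + B; the hypotheses make A and B positive.  The witness is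
-- λ = (λ₁^A, (λ₁ − 1)^B, 0^B) over μ = (μ₁^r).  In a splitting of (λ, μ) into two
-- Kostka points every summand of μ is constant and every summand of λ again has
-- the shape (p^A, p′^B, 0^B) with p − p′ ∈ {0, 1}, because λ drops by only one
-- after its first block.  Equal sizes then give A p + B p′ = r q with 0 < q < μ₁,
-- so A + B divides r q or r (q + 1); being coprime to r, it is at most q + 1 ≤ μ₁,
-- which is impossible.
module Submission where

open import Defs
open import Data.Nat
open import Data.Nat.Properties
open import Data.Nat.GCD using (gcd)
open import Data.Nat.Divisibility using (_∣_; divides; ∣⇒≤; ∣-refl; ∣-reflexive)
open import Data.Nat.Coprimality using (Coprime; coprime-divisor; gcd≡1⇒coprime)
  renaming (sym to coprime-sym)
open import Data.Nat.Tactic.RingSolver using (solve-∀)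
open import Data.Fin using (Fin; toℕ; fromℕ<) renaming (zero to fzero; suc to fsuc)
open import Data.Fin.Properties using (toℕ-fromℕ<; toℕ<n)
open import Data.Vec using (Vec; []; _∷_; lookup; zipWith; replicate; head)
open import Data.Vec.Properties using (lookup-replicate)
open import Data.Product using (_,_; proj₁; proj₂; ∃)
open import Data.Sum using (_⊎_; inj₁; inj₂)
open import Data.Empty using (⊥; ⊥-elim)
open import Relation.Nullary using (¬_; yes; no; contradiction)
open import Relation.Binary.PropositionalEquality

m≤n⇒∃[o]o+m≡n : ∀ {m n} → m ≤ n → ∃ λ o → o + m ≡ n
m≤n⇒∃[o]o+m≡n {m} m≤n with m≤n⇒∃[o]m+o≡n m≤n
... | o , m+o≡n = o , trans (+-comm o m) m+o≡n

m+n+1<2m⇒n≤m : ∀ m n → m + n + 1 < 2 * m → n ≤ m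
m+n+1<2m⇒n≤m m n h = +-cancelˡ-≤ m n m (begin
  m + n       ≤⟨ m≤m+n (m + n) 1 ⟩
  m + n + 1   ≤⟨ <⇒≤ h ⟩
  2 * m       ≡⟨ cong (m +_) (+-identityʳ m) ⟩
  m + m       ∎)
  where open ≤-Reasoning

coprime⇒≤ : ∀ {n r q} → Coprime n r → n ∣ r * q → 0 < q → n ≤ q
coprime⇒≤ {q = suc _} cop n∣rq _ = ∣⇒≤ (coprime-divisor cop n∣rq)

-- Vectors read as functions on ℕ, with the junk value 0 past the end.

at : ∀ {n} → Vec ℕ n → ℕ → ℕ
at []       _       = 0
at (x ∷ _)  zero    = x
at (_ ∷ xs) (suc k) = at xs k

fromFun : (n : ℕ) → (ℕ → ℕ) → Vec ℕ n
fromFun zero    f = []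
fromFun (suc n) f = f 0 ∷ fromFun n (λ k → f (suc k))

sumTo : (ℕ → ℕ) → ℕ → ℕ
sumTo f zero    = 0
sumTo f (suc n) = f 0 + sumTo (λ k → f (suc k)) n

sumTo-cong : ∀ n {f g} → (∀ k → k < n → f k ≡ g k) → sumTo f n ≡ sumTo g n
sumTo-cong zero    h = refl
sumTo-cong (suc n) h = cong₂ _+_ (h 0 z<s) (sumTo-cong n (λ k k<n → h (suc k) (s<s k<n)))

sumTo-mono-≤ : ∀ n {f g} → (∀ k → k < n → f k ≤ g k) → sumTo f n ≤ sumTo g n
sumTo-mono-≤ zero    h = z≤n
sumTo-mono-≤ (suc n) h = +-mono-≤ (h 0 z<s) (sumTo-mono-≤ n (λ k k<n → h (suc k) (s<s k<n)))

sumTo-const : ∀ c n → sumTo (λ _ → c) n ≡ n * c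
sumTo-const c zero    = refl
sumTo-const c (suc n) = cong (c +_) (sumTo-const c n)

total≡sumTo : ∀ {n} (v : Vec ℕ n) → total v ≡ sumTo (at v) n
total≡sumTo []      = refl
total≡sumTo (x ∷ v) = cong (x +_) (total≡sumTo v)

psum≡sumTo : ∀ {n} k (v : Vec ℕ n) → psum k v ≡ sumTo (at v) k
psum≡sumTo zero    v       = refl
psum≡sumTo (suc k) []      = sym (trans (sumTo-const 0 k) (*-zeroʳ k))
psum≡sumTo (suc k) (x ∷ v) = cong (x +_) (psum≡sumTo k v)

psum≤total : ∀ {n} k (v : Vec ℕ n) → psum k v ≤ total v
psum≤total zero    v       = z≤n
psum≤total (suc k) []      = ≤-refl
psum≤total (suc k) (x ∷ v) = +-monoʳ-≤ x (psum≤total k v)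

total-pointwise : ∀ {n} (v : Vec ℕ n) {f} → (∀ k → k < n → at v k ≡ f k) →
                  total v ≡ sumTo f n
total-pointwise {n} v h = trans (total≡sumTo v) (sumTo-cong n h)

total≡0⇒≡replicate : ∀ {n} (v : Vec ℕ n) → total v ≡ 0 → v ≡ replicate n 0
total≡0⇒≡replicate []      _ = refl
total≡0⇒≡replicate (x ∷ v) h =
  cong₂ _∷_ (m+n≡0⇒m≡0 x h) (total≡0⇒≡replicate v (m+n≡0⇒n≡0 x h))

at-fromFun : ∀ n f k → k < n → at (fromFun n f) k ≡ f k
at-fromFun (suc n) f zero    _         = refl
at-fromFun (suc n) f (suc k) (s<s k<n) = at-fromFun n _ k k<n

at-replicate : ∀ n c k → k < n → at (replicate n c) k ≡ c
at-replicate (suc n) c zero    _         = refl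
at-replicate (suc n) c (suc k) (s<s k<n) = at-replicate n c k k<n

at-zipWith : ∀ {n} (u w : Vec ℕ n) k → at (zipWith _+_ u w) k ≡ at u k + at w k
at-zipWith []      []      k       = refl
at-zipWith (x ∷ u) (y ∷ w) zero    = refl
at-zipWith (x ∷ u) (y ∷ w) (suc k) = at-zipWith u w k

lookup≡at : ∀ {n} (v : Vec ℕ n) (i : Fin n) → lookup v i ≡ at v (toℕ i)
lookup≡at (x ∷ v) fzero    = refl
lookup≡at (x ∷ v) (fsuc i) = lookup≡at v i

at-beyond : ∀ {n} (v : Vec ℕ n) k → n ≤ k → at v k ≡ 0
at-beyond []      k       _         = refl
at-beyond (x ∷ v) (suc k) (s≤s n≤k) = at-beyond v k n≤k

at-antitone : ∀ {n} (v : Vec ℕ n) → NonIncreasing v → ∀ {i j} → i ≤ j → at v j ≤ at v i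
at-antitone {n} v ni {i} {j} i≤j with j <? n
... | no  j≮n = ≤-trans (≤-reflexive (at-beyond v j (≮⇒≥ j≮n))) z≤n
... | yes j<n = subst₂ _≤_ (atℕ j<n) (atℕ i<n)
                  (ni (fromℕ< i<n) (fromℕ< j<n)
                      (subst₂ _≤_ (sym (toℕ-fromℕ< i<n)) (sym (toℕ-fromℕ< j<n)) i≤j))
  where
  i<n : i < n
  i<n = ≤-<-trans i≤j j<n
  atℕ : ∀ {k} (k<n : k < n) → lookup v (fromℕ< k<n) ≡ at v k
  atℕ k<n = trans (lookup≡at v _) (cong (at v) (toℕ-fromℕ< k<n))

NonIncreasing-fromFun : ∀ n f → (∀ {i j} → i ≤ j → f j ≤ f i) → NonIncreasing (fromFun n f)
NonIncreasing-fromFun n f anti i j i≤j =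
  subst₂ _≤_ (sym (atFin j)) (sym (atFin i)) (anti i≤j)
  where
  atFin : ∀ i → lookup (fromFun n f) i ≡ f (toℕ i)
  atFin i = trans (lookup≡at (fromFun n f) i) (at-fromFun n f (toℕ i) (toℕ<n i))

summand-drop : ∀ {n} (u w : Vec ℕ n) → NonIncreasing u → NonIncreasing w →
               ∀ {i j} d → i ≤ j → at u i + at w i ≡ d + (at u j + at w j) →
               at u i ≤ d + at u j
summand-drop u w nu nw {i} {j} d i≤j eq = +-cancelʳ-≤ (at u j + at w j) _ _ (begin
  at u i + (at u j + at w j)       ≡⟨ x+[y+z]≡y+[x+z] (at u i) (at u j) (at w j) ⟩
  at u j + (at u i + at w j)       ≤⟨ +-monoʳ-≤ (at u j) (+-monoʳ-≤ (at u i) (at-antitone w nw i≤j)) ⟩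
  at u j + (at u i + at w i)       ≡⟨ cong (at u j +_) eq ⟩
  at u j + (d + (at u j + at w j)) ≡⟨ x+[y+z]≡y+[x+z] (at u j) d _ ⟩
  d + (at u j + (at u j + at w j)) ≡⟨ sym (+-assoc d (at u j) _) ⟩
  d + at u j + (at u j + at w j)   ∎)
  where
  open ≤-Reasoning
  x+[y+z]≡y+[x+z] : ∀ x y z → x + (y + z) ≡ y + (x + z)
  x+[y+z]≡y+[x+z] = solve-∀

summand-flat : ∀ {n} (u w : Vec ℕ n) → NonIncreasing u → NonIncreasing w →
               (f : ℕ → ℕ) → (∀ k → k < n → at u k + at w k ≡ f k) →
               ∀ i j → i ≤ j → j < n → f i ≡ f j → at u j ≡ at u i
summand-flat u w nu nw f sum i j i≤j j<n fi≡fj = ≤-antisym (at-antitone u nu i≤j)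
  (summand-drop u w nu nw 0 i≤j
    (trans (sum i (≤-<-trans i≤j j<n)) (trans fi≡fj (sym (sum j j<n)))))

block : ℕ → ℕ → ℕ → ℕ → ℕ → ℕ
block zero    zero    x y k       = 0
block (suc A) B       x y zero    = x
block (suc A) B       x y (suc k) = block A B x y k
block zero    (suc B) x y zero    = y
block zero    (suc B) x y (suc k) = block zero B x y k

block-first : ∀ A B x y {k} → k < A → block A B x y k ≡ x
block-first (suc A) B x y {zero}  _         = refl
block-first (suc A) B x y {suc k} (s<s k<A) = block-first A B x y k<A

block-second : ∀ A B x y {k} → A ≤ k → k < A + B → block A B x y k ≡ y
block-second (suc A) B       x y {suc k} (s≤s A≤k) (s<s k<AB) = block-second A B x y A≤k k<AB
block-second zero    (suc B) x y {zero}  _         _          = refl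
block-second zero    (suc B) x y {suc k} _         (s<s k<B)  = block-second zero B x y z≤n k<B

block-beyond : ∀ A B x y {k} → A + B ≤ k → block A B x y k ≡ 0
block-beyond zero    zero    x y         _         = refl
block-beyond (suc A) B       x y {suc k} (s≤s AB≤k) = block-beyond A B x y AB≤k
block-beyond zero    (suc B) x y {suc k} (s≤s B≤k)  = block-beyond zero B x y B≤k

block-≤-second : ∀ B x y k → block zero B x y k ≤ y
block-≤-second zero    x y k       = z≤n
block-≤-second (suc B) x y zero    = ≤-refl
block-≤-second (suc B) x y (suc k) = block-≤-second B x y k

block-≤-first : ∀ A B x y → y ≤ x → ∀ k → block A B x y k ≤ x
block-≤-first zero    zero    x y y≤x k       = z≤n
block-≤-first (suc A) B       x y y≤x zero    = ≤-refl
block-≤-first (suc A) B       x y y≤x (suc k) = block-≤-first A B x y y≤x k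
block-≤-first zero    (suc B) x y y≤x k       = ≤-trans (block-≤-second (suc B) x y k) y≤x

block-antitone : ∀ A B x y → y ≤ x → ∀ {i j} → i ≤ j → block A B x y j ≤ block A B x y i
block-antitone zero    zero    x y y≤x _         = z≤n
block-antitone (suc A) B       x y y≤x {zero}  {j}     _         = block-≤-first (suc A) B x y y≤x j
block-antitone (suc A) B       x y y≤x {suc i} {suc j} (s≤s i≤j) = block-antitone A B x y y≤x i≤j
block-antitone zero    (suc B) x y y≤x {zero}  {j}     _         = block-≤-second (suc B) x y j
block-antitone zero    (suc B) x y y≤x {suc i} {suc j} (s≤s i≤j) = block-antitone zero B x y y≤x i≤j

block-≥-second : ∀ A B x y → y ≤ x → ∀ {k} → k < A + B → y ≤ block A B x y k
block-≥-second (suc A) B       x y y≤x {zero}  _          = y≤x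
block-≥-second (suc A) B       x y y≤x {suc k} (s<s k<AB) = block-≥-second A B x y y≤x k<AB
block-≥-second zero    (suc B) x y y≤x {zero}  _          = ≤-refl
block-≥-second zero    (suc B) x y y≤x {suc k} (s<s k<B)  = block-≥-second zero B x y y≤x k<B

sumTo-block : ∀ A B Z x y → sumTo (block A B x y) (A + B + Z) ≡ A * x + B * y
sumTo-block (suc A) B       Z x y = trans (cong (x +_) (sumTo-block A B Z x y)) (sym (+-assoc x (A * x) (B * y)))
sumTo-block zero    (suc B) Z x y = cong (y +_) (sumTo-block zero B Z x y)
sumTo-block zero    zero    Z x y = trans (sumTo-const 0 Z) (*-zeroʳ Z)

summand-block : ∀ {n} A B x y (u w : Vec ℕ n) → NonIncreasing u → NonIncreasing w →
                (∀ k → k < n → at u k + at w k ≡ block A B x y k) →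
                ∀ k → k < n → at u k ≡ block A B (at u 0) (at u A) k
summand-block {n} A B x y u w nu nw sum k k<n with k <? A | k <? A + B
... | yes k<A | _ = trans (summand-flat u w nu nw (block A B x y) sum 0 k z≤n k<n
                            (trans (block-first A B x y (≤-<-trans z≤n k<A))
                                   (sym (block-first A B x y k<A))))
                          (sym (block-first A B _ _ k<A))
... | no k≮A | yes k<AB = trans (summand-flat u w nu nw (block A B x y) sum A k (≮⇒≥ k≮A) k<n
                                   (trans (block-second A B x y ≤-refl (≤-<-trans (≮⇒≥ k≮A) k<AB))
                                          (sym (block-second A B x y (≮⇒≥ k≮A) k<AB))))
                                 (sym (block-second A B _ _ (≮⇒≥ k≮A) k<AB))
... | _ | no k≮AB = trans (m+n≡0⇒m≡0 _ (trans (sum k k<n) (block-beyond A B x y (≮⇒≥ k≮AB))))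
                          (sym (block-beyond A B _ _ (≮⇒≥ k≮AB)))

summand-const : ∀ {n} (u w : Vec ℕ n) → NonIncreasing u → NonIncreasing w →
                ∀ c → (∀ k → k < n → at u k + at w k ≡ c) → total u ≡ n * at u 0
summand-const {n} u w nu nw c sum = trans
  (total-pointwise u (λ k k<n → summand-flat u w nu nw (λ _ → c) sum 0 k z≤n k<n refl))
  (sumTo-const (at u 0) n)

KostkaPoint-total≡0 : ∀ r {α β : Vec ℕ r} → KostkaPoint r (α , β) → total α ≡ 0 →
                      (α , β) ≡ zeroPt r
KostkaPoint-total≡0 r {α} {β} (_ , _ , tα≡tβ , _) tα≡0 =
  cong₂ _,_ (total≡0⇒≡replicate α tα≡0) (total≡0⇒≡replicate β (trans (sym tα≡tβ) tα≡0))

block-balance-impossible : ∀ A B p p′ q → Coprime (A + B) (A + B + B) →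
  p′ ≤ p → p ≤ suc p′ → A * p + B * p′ ≡ (A + B + B) * q → 0 < q → suc q < A + B → ⊥
block-balance-impossible A B p p′ q cop p′≤p p≤1+p′ balance 0<q 1+q<A+B
  with m≤n⇒m<n∨m≡n p≤1+p′
... | inj₁ (s≤s p≤p′) = <⇒≱ (<-trans (n<1+n q) 1+q<A+B) (coprime⇒≤ cop (divides p′ (begin
  (A + B + B) * q   ≡⟨ sym balance ⟩
  A * p + B * p′    ≡⟨ cong (λ t → A * t + B * p′) (≤-antisym p≤p′ p′≤p) ⟩
  A * p′ + B * p′   ≡⟨ flat A B p′ ⟩
  p′ * (A + B)      ∎)) 0<q)
  where
  open ≡-Reasoning
  flat : ∀ A B p′ → A * p′ + B * p′ ≡ p′ * (A + B)
  flat = solve-∀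
... | inj₂ refl = <⇒≱ 1+q<A+B (coprime⇒≤ cop (divides (suc (suc p′)) (begin
  (A + B + B) * suc q                  ≡⟨ *-suc (A + B + B) q ⟩
  A + B + B + (A + B + B) * q          ≡⟨ cong (A + B + B +_) (sym balance) ⟩
  A + B + B + (A * suc p′ + B * p′)    ≡⟨ rise A B p′ ⟩
  suc (suc p′) * (A + B)               ∎)) z<s)
  where
  open ≡-Reasoning
  rise : ∀ A B p′ → A + B + B + (A * suc p′ + B * p′) ≡ suc (suc p′) * (A + B)
  rise = solve-∀

-- The parameters are A − 1 and B − 1, so that L = λ₁ and M = μ₁.

module Witness (a b : ℕ) where

  A B M y L r : ℕ
  A = suc a
  B = suc b
  M = a + B
  y = M + b
  L = M + B
  r = suc L

  lam mu : Vec ℕ r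
  lam = fromFun r (block A B L y)
  mu  = replicate r M

  L≡1+y : L ≡ suc y
  L≡1+y = +-suc M b

  y≤L : y ≤ L
  y≤L = subst (y ≤_) (sym L≡1+y) (n≤1+n y)

  M≤y : M ≤ y
  M≤y = m≤m+n M b

  sizes : A * L + B * y ≡ r * M
  sizes = identity a b
    where
    identity : ∀ a b → suc a * (a + suc b + suc b) + suc b * (a + suc b + b)
                     ≡ suc (a + suc b + suc b) * (a + suc b)
    identity = solve-∀

  at-lam : ∀ k → k < r → at lam k ≡ block A B L y k
  at-lam = at-fromFun r (block A B L y)

  at-mu : ∀ k → k < r → at mu k ≡ M
  at-mu = at-replicate r M

  total-lam : total lam ≡ A * L + B * y
  total-lam = trans (total-pointwise lam at-lam) (sumTo-block A B B L y)

  total-mu : total mu ≡ r * M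
  total-mu = trans (total-pointwise mu at-mu) (sumTo-const M r)

  dominates : Dominates lam mu
  dominates k k≤r with k ≤? A + B
  ... | yes k≤A+B =
    subst₂ _≤_ (sym (psum≡sumTo k mu)) (sym (psum≡sumTo k lam)) (sumTo-mono-≤ k entry≤)
    where
    entry≤ : ∀ i → i < k → at mu i ≤ at lam i
    entry≤ i i<k = subst₂ _≤_ (sym (at-mu i i<r)) (sym (at-lam i i<r))
                     (≤-trans M≤y (block-≥-second A B L y y≤L (<-≤-trans i<k k≤A+B)))
      where
      i<r : i < r
      i<r = <-≤-trans i<k k≤r
  ... | no k≰A+B with m≤n⇒∃[o]m+o≡n (≰⇒≥ k≰A+B)
  ...   | Z , refl = begin
    psum k mu                          ≤⟨ psum≤total k mu ⟩
    total mu                           ≡⟨ total-mu ⟩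
    r * M                              ≡⟨ sizes ⟨
    A * L + B * y                      ≡⟨ sumTo-block A B Z L y ⟨
    sumTo (block A B L y) (A + B + Z)  ≡⟨ sumTo-cong k (λ i i<k → sym (at-lam i (<-≤-trans i<k k≤r))) ⟩
    sumTo (at lam) k                   ≡⟨ sym (psum≡sumTo k lam) ⟩
    psum k lam                         ∎
    where open ≤-Reasoning

  kostka : KostkaPoint r (lam , mu)
  kostka = NonIncreasing-fromFun r (block A B L y) (block-antitone A B L y y≤L)
         , (λ i j _ → ≤-reflexive (trans (lookup-replicate j M) (sym (lookup-replicate i M))))
         , trans total-lam (trans sizes (sym total-mu))
         , dominates

  nonzero : ¬ (lam , mu) ≡ zeroPt r
  nonzero e = 1+n≢0 (trans (sym L≡1+y) (cong (λ x → head (proj₁ x)) e))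

  no-proper-split : Coprime (A + B) r → ∀ α β γ δ →
                    KostkaPoint r (α , β) → KostkaPoint r (γ , δ) →
                    (lam , mu) ≡ (α , β) ⊕ (γ , δ) → total α ≢ 0 → total γ ≢ 0 → ⊥
  no-proper-split cop α β γ δ (nα , nβ , tα≡tβ , _) (nγ , nδ , tγ≡tδ , _) e tα≢0 tγ≢0 =
    block-balance-impossible A B p p′ q cop p′≤p p≤1+p′ balance (positive tα≢0 (trans tα≡tβ tβ))
      (s<s (subst (q <_) (sum-mu 0 z<s) (m<m+n q (positive tγ≢0 (trans tγ≡tδ tδ)))))
    where
    sum-lam : ∀ k → k < r → at α k + at γ k ≡ block A B L y k
    sum-lam k k<r = trans (sym (at-zipWith α γ k))
                          (trans (cong (λ v → at v k) (sym (cong proj₁ e))) (at-lam k k<r))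

    sum-mu : ∀ k → k < r → at β k + at δ k ≡ M
    sum-mu k k<r = trans (sym (at-zipWith β δ k))
                         (trans (cong (λ v → at v k) (sym (cong proj₂ e))) (at-mu k k<r))

    p p′ q : ℕ
    p  = at α 0
    p′ = at α A
    q  = at β 0

    tβ : total β ≡ r * q
    tβ = summand-const β δ nβ nδ M sum-mu

    tδ : total δ ≡ r * at δ 0
    tδ = summand-const δ β nδ nβ M (λ k k<r → trans (+-comm (at δ k) (at β k)) (sum-mu k k<r))

    A<A+B : A < A + B
    A<A+B = m<m+n A z<s

    A<r : A < r
    A<r = <-≤-trans A<A+B (m≤m+n (A + B) B)

    balance : A * p + B * p′ ≡ r * q
    balance = trans (sym (trans (total-pointwise α (summand-block A B L y α γ nα nγ sum-lam))
                                (sumTo-block A B B p p′)))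
                    (trans tα≡tβ tβ)

    p′≤p : p′ ≤ p
    p′≤p = at-antitone α nα z≤n

    p≤1+p′ : p ≤ suc p′
    p≤1+p′ = summand-drop α γ nα nγ 1 z≤n (begin
      at α 0 + at γ 0        ≡⟨ sum-lam 0 z<s ⟩
      L                      ≡⟨ L≡1+y ⟩
      suc y                  ≡⟨ cong suc (block-second A B L y ≤-refl A<A+B) ⟨
      suc (block A B L y A)  ≡⟨ cong suc (sum-lam A A<r) ⟨
      1 + (at α A + at γ A)  ∎)
      where open ≡-Reasoning

    positive : ∀ {t c} → t ≢ 0 → t ≡ r * c → 0 < c
    positive t≢0 t≡rc = n≢0⇒n>0 λ c≡0 → t≢0 (trans t≡rc (trans (cong (r *_) c≡0) (*-zeroʳ r)))

  splits-trivially : Coprime (A + B) r → (u v : Point r) → KostkaPoint r u → KostkaPoint r v →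
                     (lam , mu) ≡ u ⊕ v → (u ≡ zeroPt r) ⊎ (v ≡ zeroPt r)
  splits-trivially cop (α , β) (γ , δ) kαβ kγδ e with total α ≟ 0 | total γ ≟ 0
  ... | yes tα≡0 | _        = inj₁ (KostkaPoint-total≡0 r kαβ tα≡0)
  ... | no _     | yes tγ≡0 = inj₂ (KostkaPoint-total≡0 r kγδ tγ≡0)
  ... | no tα≢0  | no tγ≢0  = ⊥-elim (no-proper-split cop α β γ δ kαβ kγδ e tα≢0 tγ≢0)

  initial : Coprime (A + B) r → Initial r L M
  initial cop = (lam , mu) , (kostka , nonzero , splits-trivially cop) , refl , refl

theorem6p9 : (l1 m1 : ℕ) → 1 ≤ m1 → m1 ≤ l1 →
    gcd (l1 + 1) (m1 + 1) ≡ 1 → l1 + 1 < 2 * m1 →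
    Initial (l1 + 1) l1 m1
theorem6p9 l1 m1 1≤m1 m1≤l1 gcd≡1 l1+1<2m1 with m≤n⇒∃[o]m+o≡n m1≤l1
... | zero , refl = contradiction
  (gcd≡1⇒coprime gcd≡1 (∣-reflexive (cong (_+ 1) (sym (+-identityʳ m1))) , ∣-refl))
  (>⇒≢ (+-monoˡ-≤ 1 1≤m1))
... | suc b , refl with m≤n⇒∃[o]o+m≡n (m+n+1<2m⇒n≤m m1 (suc b) l1+1<2m1)
...   | a , refl = subst (λ r → Initial r L M) (+-comm 1 L) (initial cop)
  where
  open Witness a b using (A; B; L; M; r; initial)
  cop : Coprime (A + B) r
  cop = coprime-sym (subst₂ Coprime (+-comm _ 1) (+-comm _ 1) (gcd≡1⇒coprime gcd≡1))
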